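{- Let $n\ge1$. There is a bijection $\varphi$ from the set $\mathcal{T}_n$ of plane trees with $n$ edges to the set $\mathcal{S}_n(321)$ of $321$-avoiding permutations of $\{1,\dots,n\}$ such that, for every $T\in\mathcal{T}_n$ with $\pi=\varphi(T)$: (1) the number of young leaves of $T$ equals the number of indices $i\in\{1,\dots,n-1\}$ such that both $\pi_i$ and $\pi_{i+1}$ are deficiencies of $\pi$, plus $1$ if $\pi_n<n$ (plus $0$ otherwise); (2) the number of old leaves of $T$ equals the number of weak excedances $\pi_i$ of $\pi$ that are not immediately followed by another weak excedance (i.e. either $i=n$, or $\pi_{i+1}$ is not a weak excedance).
   Context: A plane tree is a rooted tree with the children of each vertex linearly ordered left to right; a leaf is a vertex with no children; a leaf is old if it is the leftmost child of its parent, young otherwise. A permutation $\pi=\pi_1\cdots\pi_n$ avoids $321$ if there are no indices $a<b<c$ with $\pi_a>\pi_b>\pi_c$. The entry $\pi_i$ is a weak excedance if $\pi_i\ge i$ and a deficiency if $\pi_i<i$. -}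

module Defs where

open import Data.Nat using (ℕ; zero; suc; _+_; _<ᵇ_)
open import Data.Bool using (Bool; true; false; not)
open import Data.List using (List; []; _∷_; map; length)
open import Data.Fin using (Fin; toℕ; _<_; _>_)
open import Data.Fin.Permutation using (Permutation′; _⟨$⟩ʳ_)
open import Data.List using (allFin)
open import Data.Product using (Σ; _×_)
open import Relation.Binary.PropositionalEquality using (_≡_)
open import Relation.Nullary using (¬_)

data PTree : Set where
  node : List PTree → PTree

mutual
  edges : PTree → ℕ
  edges (node cs) = length cs + edgesL cs

  edgesL : List PTree → ℕ
  edgesL [] = 0
  edgesL (t ∷ ts) = edges t + edgesL ts

isLeaf : PTree → Bool
isLeaf (node []) = true
isLeaf (node (_ ∷ _)) = false

b2n : Bool → ℕ
b2n true = 1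
b2n false = 0

mutual
  -- old leaves: leaves that are the leftmost child of their parent
  oldLeaves : PTree → ℕ
  oldLeaves (node []) = 0
  oldLeaves (node (c ∷ cs)) = b2n (isLeaf c) + oldLeavesL (c ∷ cs)

  oldLeavesL : List PTree → ℕ
  oldLeavesL [] = 0
  oldLeavesL (t ∷ ts) = oldLeaves t + oldLeavesL ts

mutual
  -- young leaves: leaves that are not the leftmost child of their parent
  youngLeaves : PTree → ℕ
  youngLeaves (node []) = 0
  youngLeaves (node (c ∷ cs)) = leafCount cs + youngLeavesL (c ∷ cs)

  youngLeavesL : List PTree → ℕ
  youngLeavesL [] = 0
  youngLeavesL (t ∷ ts) = youngLeaves t + youngLeavesL ts

  leafCount : List PTree → ℕ
  leafCount [] = 0
  leafCount (t ∷ ts) = b2n (isLeaf t) + leafCount ts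

Trees : ℕ → Set
Trees n = Σ PTree (λ t → edges t ≡ n)

-- Permutations of {1..n}, encoded 0-indexed on Fin n: π_i (1-indexed) corresponds
-- to toℕ (π ⟨$⟩ʳ i) + 1 at position toℕ i + 1.
Perm : ℕ → Set
Perm n = Permutation′ n

_≈ₚ_ : ∀ {n} → Perm n → Perm n → Set
π ≈ₚ σ = ∀ i → π ⟨$⟩ʳ i ≡ σ ⟨$⟩ʳ i

Avoids321 : ∀ {n} → Perm n → Set
Avoids321 {n} π = (a b c : Fin n) → a < b → b < c →
  ¬ ((π ⟨$⟩ʳ a) > (π ⟨$⟩ʳ b) × (π ⟨$⟩ʳ b) > (π ⟨$⟩ʳ c))

isDeficiency : ∀ {n} → Perm n → Fin n → Bool
isDeficiency π i = toℕ (π ⟨$⟩ʳ i) <ᵇ toℕ i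

isWeakExc : ∀ {n} → Perm n → Fin n → Bool
isWeakExc π i = not (isDeficiency π i)

seq : ∀ {n} → (Fin n → Bool) → List Bool
seq {n} f = map f (allFin n)

adjTT : List Bool → ℕ
adjTT [] = 0
adjTT (x ∷ []) = 0
adjTT (true ∷ true ∷ ys) = 1 + adjTT (true ∷ ys)
adjTT (_ ∷ y ∷ ys) = adjTT (y ∷ ys)

lastTrue : List Bool → ℕ
lastTrue [] = 0
lastTrue (x ∷ []) = b2n x
lastTrue (_ ∷ y ∷ ys) = lastTrue (y ∷ ys)

runEnds : List Bool → ℕ
runEnds [] = 0
runEnds (x ∷ []) = b2n x
runEnds (true ∷ false ∷ ys) = 1 + runEnds (false ∷ ys)
runEnds (_ ∷ y ∷ ys) = runEnds (y ∷ ys)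

stat1 : ∀ {n} → Perm n → ℕ
stat1 π = adjTT (seq (isDeficiency π)) + lastTrue (seq (isDeficiency π))

stat2 : ∀ {n} → Perm n → ℕ
stat2 π = runEnds (seq (isWeakExc π))

-- Both families are grown by n insertion steps driven by a code x₁, …, xₙ with
-- 1 ≤ xᵢ ≤ 1 + xᵢ₋₁ (x₀ = 0). On trees, step i hangs a new rightmost leaf below the
-- vertex at depth xᵢ − 1 of the rightmost path, which has length xᵢ₋₁. On permutations,
-- step i appends a last entry, shifting the larger entries up: the entry i (a weak
-- excedance) when xᵢ = 1 + xᵢ₋₁, and the deficiency i − xᵢ otherwise. Each plane tree has
-- exactly one code. So does each 321-avoiding permutation: its last entry must exceed the
-- lower entry of every inversion before it, and for the permutation of a code these lower
-- entries reach up to exactly i − 1 − xᵢ₋₁. Grafting onto the rightmost leaf creates an old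
-- leaf and destroys the previous rightmost leaf; grafting higher up creates a young leaf.
-- Hence both leaf counts are read off the deficiency word of φ(T) step by step.

module Submission where

open import Defs
open import Data.Bool using (Bool; true; false; not; if_then_else_)
open import Data.Fin using (Fin; toℕ; fromℕ; fromℕ<; inject₁; punchIn) renaming (zero to fzero; suc to fsuc)
import Data.Fin as Fin
open import Data.Fin.Permutation
  using (Permutation; _⟨$⟩ʳ_; _⟨$⟩ˡ_; insert; remove; id; inverseʳ; insert-punchIn; insert-remove)
open import Data.Fin.Properties
  using (toℕ<n; toℕ-fromℕ; toℕ-fromℕ<; toℕ-inject₁; toℕ-injective; inject₁ℕ<; punchIn-injective)
open import Data.List using (List; []; _∷_; map; length; allFin; tabulate; _∷ʳ_)
open import Data.List.NonEmpty using (List⁺; [_]; _∷⁺_; toList) renaming (head to head⁺; tail to tail⁺)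
open import Data.List.Properties using (map-tabulate; map-cong; map-++; map-∘)
open import Data.Maybe using (Maybe; just; nothing) renaming (map to mapMaybe)
open import Data.Maybe.Properties using (just-injective)
open import Data.Nat using (ℕ; zero; suc; _+_; _∸_; _≤_; _<_; z≤n; s≤s; s≤s⁻¹; z<s; _<ᵇ_; pred)
open import Data.Nat.Properties
open import Algebra.Properties.CommutativeSemigroup +-commutativeSemigroup using (x∙yz≈y∙xz; interchange)
open import Data.Product using (Σ; _×_; ∃; proj₁; proj₂; _,_; map₁) renaming (map to map×)
open import Data.Product.Properties using (,-injective)
open import Function using (_∘_)
open import Relation.Binary.PropositionalEquality hiding ([_])
open import Relation.Nullary using (¬_; yes; no; does; contradiction)
open import Relation.Nullary.Decidable using (dec-true; dec-false)

-- Inserting a last entry into a permutation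

punchInℕ : ℕ → ℕ → ℕ
punchInℕ zero    j       = suc j
punchInℕ (suc i) zero    = zero
punchInℕ (suc i) (suc j) = suc (punchInℕ i j)

toℕ-punchIn : ∀ {n} (i : Fin (suc n)) (j : Fin n) → toℕ (punchIn i j) ≡ punchInℕ (toℕ i) (toℕ j)
toℕ-punchIn fzero    j        = refl
toℕ-punchIn (fsuc i) fzero    = refl
toℕ-punchIn (fsuc i) (fsuc j) = cong suc (toℕ-punchIn i j)

punchInℕ-< : ∀ {i j} → j < i → punchInℕ i j ≡ j
punchInℕ-< {suc i} {zero}  _         = refl
punchInℕ-< {suc i} {suc j} (s≤s j<i) = cong suc (punchInℕ-< j<i)

punchInℕ-≥ : ∀ {i j} → i ≤ j → punchInℕ i j ≡ suc j
punchInℕ-≥ {zero}  {j}     _         = refl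
punchInℕ-≥ {suc i} {suc j} (s≤s i≤j) = cong suc (punchInℕ-≥ i≤j)

punchInℕ-mono-< : ∀ i {j k} → j < k → punchInℕ i j < punchInℕ i k
punchInℕ-mono-< zero                    j<k       = s≤s j<k
punchInℕ-mono-< (suc i) {zero}  {suc k} _         = z<s
punchInℕ-mono-< (suc i) {suc j} {suc k} (s≤s j<k) = s≤s (punchInℕ-mono-< i j<k)

punchInℕ-cancel-< : ∀ i {j k} → punchInℕ i j < punchInℕ i k → j < k
punchInℕ-cancel-< zero                    (s≤s j<k) = j<k
punchInℕ-cancel-< (suc i) {zero}  {zero}  ()
punchInℕ-cancel-< (suc i) {zero}  {suc k} _         = z<s
punchInℕ-cancel-< (suc i) {suc j} {zero}  ()
punchInℕ-cancel-< (suc i) {suc j} {suc k} (s≤s p)   = s≤s (punchInℕ-cancel-< i p)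

j≤punchInℕ : ∀ i j → j ≤ punchInℕ i j
j≤punchInℕ zero    j       = n≤1+n j
j≤punchInℕ (suc i) zero    = z≤n
j≤punchInℕ (suc i) (suc j) = s≤s (j≤punchInℕ i j)

<punchInℕ⇒≤ : ∀ {i j} → i < punchInℕ i j → i ≤ j
<punchInℕ⇒≤ {zero}          _       = z≤n
<punchInℕ⇒≤ {suc i} {suc j} (s≤s p) = s≤s (<punchInℕ⇒≤ p)

<ᵇ-true : ∀ {a b} → a < b → (a <ᵇ b) ≡ true
<ᵇ-true {a} {b} = dec-true (a <? b)

<ᵇ-false : ∀ {a b} → b ≤ a → (a <ᵇ b) ≡ false
<ᵇ-false {a} {b} b≤a = dec-false (a <? b) (≤⇒≯ b≤a)

data LastView : ∀ {n} → Fin (suc n) → Set where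
  last   : ∀ {n} → LastView (fromℕ n)
  inject : ∀ {n} (k : Fin n) → LastView (inject₁ k)

lastView : ∀ {n} (k : Fin (suc n)) → LastView k
lastView {zero}  fzero    = last
lastView {suc n} fzero    = inject fzero
lastView {suc n} (fsuc k) with lastView k
... | last     = last
... | inject j = inject (fsuc j)

inject₁-mono-< : ∀ {n} {a b : Fin n} → toℕ a < toℕ b → toℕ (inject₁ a) < toℕ (inject₁ b)
inject₁-mono-< {a = a} {b} = subst₂ _<_ (sym (toℕ-inject₁ a)) (sym (toℕ-inject₁ b))

inject₁-cancel-< : ∀ {n} {a b : Fin n} → toℕ (inject₁ a) < toℕ (inject₁ b) → toℕ a < toℕ b
inject₁-cancel-< {a = a} {b} = subst₂ _<_ (toℕ-inject₁ a) (toℕ-inject₁ b)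

inject₁<fromℕ : ∀ {n} (a : Fin n) → toℕ (inject₁ a) < toℕ (fromℕ n)
inject₁<fromℕ {n} a = subst (toℕ (inject₁ a) <_) (sym (toℕ-fromℕ n)) (inject₁ℕ< a)

fromℕ≮inject₁ : ∀ {n} (a : Fin n) → ¬ toℕ (fromℕ n) < toℕ (inject₁ a)
fromℕ≮inject₁ a = <-asym (inject₁<fromℕ a)

punchIn-fromℕ : ∀ {n} (k : Fin n) → punchIn (fromℕ n) k ≡ inject₁ k
punchIn-fromℕ fzero    = refl
punchIn-fromℕ (fsuc k) = cong fsuc (punchIn-fromℕ k)

Inversion : ∀ {n} → Perm n → Fin n → Fin n → Set
Inversion π a b = toℕ a < toℕ b × toℕ (π ⟨$⟩ʳ b) < toℕ (π ⟨$⟩ʳ a)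

module _ {m n : ℕ} (j : Fin (suc n)) (π : Permutation m n) where

  private
    σ = insert (fromℕ m) j π

  insert-last-last : σ ⟨$⟩ʳ fromℕ m ≡ j
  insert-last-last with fromℕ m Fin.≟ fromℕ m
  ... | yes _   = refl
  ... | no  m≢m = contradiction refl m≢m

  insert-last-inject₁ : ∀ k → σ ⟨$⟩ʳ inject₁ k ≡ punchIn j (π ⟨$⟩ʳ k)
  insert-last-inject₁ k = trans (cong (σ ⟨$⟩ʳ_) (sym (punchIn-fromℕ k))) (insert-punchIn (fromℕ m) j π k)

  toℕ-insert-last-inject₁ : ∀ k → toℕ (σ ⟨$⟩ʳ inject₁ k) ≡ punchInℕ (toℕ j) (toℕ (π ⟨$⟩ʳ k))
  toℕ-insert-last-inject₁ k = trans (cong toℕ (insert-last-inject₁ k)) (toℕ-punchIn j _)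

  insert-last-inject₁-mono-< : ∀ {a b} → toℕ (π ⟨$⟩ʳ a) < toℕ (π ⟨$⟩ʳ b) →
                               toℕ (σ ⟨$⟩ʳ inject₁ a) < toℕ (σ ⟨$⟩ʳ inject₁ b)
  insert-last-inject₁-mono-< {a} {b} =
    subst₂ _<_ (sym (toℕ-insert-last-inject₁ a)) (sym (toℕ-insert-last-inject₁ b)) ∘ punchInℕ-mono-< (toℕ j)

  insert-last-inject₁-cancel-< : ∀ {a b} → toℕ (σ ⟨$⟩ʳ inject₁ a) < toℕ (σ ⟨$⟩ʳ inject₁ b) →
                                 toℕ (π ⟨$⟩ʳ a) < toℕ (π ⟨$⟩ʳ b)
  insert-last-inject₁-cancel-< {a} {b} =
    punchInℕ-cancel-< (toℕ j) ∘ subst₂ _<_ (toℕ-insert-last-inject₁ a) (toℕ-insert-last-inject₁ b)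

insert-last-cong : ∀ {m} {j j′ : Fin (suc m)} {π π′ : Perm m} → j ≡ j′ → π ≈ₚ π′ →
                   insert (fromℕ m) j π ≈ₚ insert (fromℕ m) j′ π′
insert-last-cong {j = j} {j′} {π} {π′} j≡j′ π≈π′ k with lastView k
... | last     = trans (insert-last-last j π) (trans j≡j′ (sym (insert-last-last j′ π′)))
... | inject i = trans (insert-last-inject₁ j π i)
                   (trans (cong₂ punchIn j≡j′ (π≈π′ i)) (sym (insert-last-inject₁ j′ π′ i)))

insert-last-injective : ∀ {m} {j j′ : Fin (suc m)} {π π′ : Perm m} →
                        insert (fromℕ m) j π ≈ₚ insert (fromℕ m) j′ π′ → j ≡ j′ × π ≈ₚ π′
insert-last-injective {m} {j} {j′} {π} {π′} eq = j≡j′ , λ k →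
  punchIn-injective j (π ⟨$⟩ʳ k) (π′ ⟨$⟩ʳ k)
    (trans (sym (insert-last-inject₁ j π k))
      (trans (eq (inject₁ k)) (trans (insert-last-inject₁ j′ π′ k) (cong (λ i → punchIn i (π′ ⟨$⟩ʳ k)) (sym j≡j′)))))
  where
  j≡j′ : j ≡ j′
  j≡j′ = trans (sym (insert-last-last j π)) (trans (eq (fromℕ m)) (insert-last-last j′ π′))

insert-last-remove : ∀ {m} (σ : Perm (suc m)) {π : Perm m} → π ≈ₚ remove (fromℕ m) σ →
                     insert (fromℕ m) (σ ⟨$⟩ʳ fromℕ m) π ≈ₚ σ
insert-last-remove {m} σ π≈τ k = trans (insert-last-cong refl π≈τ k) (insert-remove (fromℕ m) σ k)

avoids321-resp-≈ : ∀ {n} {π σ : Perm n} → π ≈ₚ σ → Avoids321 σ → Avoids321 π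
avoids321-resp-≈ π≈σ σ-avoids a b c a<b b<c (πb<πa , πc<πb) =
  σ-avoids a b c a<b b<c (subst₂ _<_ (cong toℕ (π≈σ b)) (cong toℕ (π≈σ a)) πb<πa ,
                          subst₂ _<_ (cong toℕ (π≈σ c)) (cong toℕ (π≈σ b)) πc<πb)

avoids321-insert-last-remove : ∀ {m} (σ : Perm (suc m)) {π : Perm m} → π ≈ₚ remove (fromℕ m) σ →
                               Avoids321 σ → Avoids321 (insert (fromℕ m) (σ ⟨$⟩ʳ fromℕ m) π)
avoids321-insert-last-remove {m} σ {π} π≈τ =
  avoids321-resp-≈ {π = insert (fromℕ m) (σ ⟨$⟩ʳ fromℕ m) π} {σ = σ} (insert-last-remove σ π≈τ)

module _ {m : ℕ} (v : Fin (suc m)) (π : Perm m) where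

  avoids321-insert-last : Avoids321 π → (∀ a b → Inversion π a b → toℕ (π ⟨$⟩ʳ b) < toℕ v) →
                          Avoids321 (insert (fromℕ m) v π)
  avoids321-insert-last π-avoids below-v a b c a<b b<c (σb<σa , σc<σb)
    with lastView a | lastView b | lastView c
  ... | _         | last      | last      = <-irrefl refl b<c
  ... | last      | inject b′ | _         = fromℕ≮inject₁ b′ a<b
  ... | _         | last      | inject c′ = fromℕ≮inject₁ c′ b<c
  ... | inject a′ | inject b′ | last      =
    <⇒≱ (below-v a′ b′ (inject₁-cancel-< a<b , insert-last-inject₁-cancel-< v π σb<σa))
        (<punchInℕ⇒≤ (subst₂ _<_ (cong toℕ (insert-last-last v π)) (toℕ-insert-last-inject₁ v π b′) σc<σb))
  ... | inject a′ | inject b′ | inject c′ =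
    π-avoids a′ b′ c′ (inject₁-cancel-< a<b) (inject₁-cancel-< b<c)
      (insert-last-inject₁-cancel-< v π σb<σa , insert-last-inject₁-cancel-< v π σc<σb)

  avoids321-insert-last⁻¹ : Avoids321 (insert (fromℕ m) v π) → Avoids321 π
  avoids321-insert-last⁻¹ σ-avoids a b c a<b b<c (πb<πa , πc<πb) =
    σ-avoids (inject₁ a) (inject₁ b) (inject₁ c) (inject₁-mono-< a<b) (inject₁-mono-< b<c)
      (insert-last-inject₁-mono-< v π πb<πa , insert-last-inject₁-mono-< v π πc<πb)

-- Codes and their permutations

head₀ : List ℕ → ℕ
head₀ []      = 0
head₀ (x ∷ _) = x

-- A code lists its steps newest first.
data Code : ℕ → List ℕ → Set where
  nil  : Code 0 []
  cons : ∀ {n x xs} → 1 ≤ x → x ≤ suc (head₀ xs) → Code n xs → Code (suc n) (x ∷ xs)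

head₀≤ : ∀ {n xs} → Code n xs → head₀ xs ≤ n
head₀≤ nil              = z≤n
head₀≤ (cons _ x≤1+h c) = ≤-trans x≤1+h (s≤s (head₀≤ c))

data Step : ℕ → ℕ → Set where
  weak      : ∀ {h} → Step (suc h) h
  deficient : ∀ {x h} → 1 ≤ x → x ≤ h → Step x h

step : ∀ {x h} → 1 ≤ x → x ≤ suc h → Step x h
step {x} {h} 1≤x x≤1+h with x ≟ suc h
... | yes refl  = weak
... | no  x≢1+h = deficient 1≤x (s≤s⁻¹ (≤∧≢⇒< x≤1+h x≢1+h))

isWeakStep : ℕ → ℕ → Bool
isWeakStep x h = does (x ≟ suc h)

isWeakStep-weak : ∀ h → isWeakStep (suc h) h ≡ true
isWeakStep-weak h = dec-true (suc h ≟ suc h) refl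

isWeakStep-deficient : ∀ {x h} → x ≤ h → isWeakStep x h ≡ false
isWeakStep-deficient {x} {h} x≤h = dec-false (x ≟ suc h) (λ x≡1+h → <-irrefl x≡1+h (s≤s x≤h))

-- The 0-based value appended by a step x after a step h, growing a permutation of size m.
lastValue : ℕ → ℕ → ℕ → ℕ
lastValue m x h = if isWeakStep x h then m else m ∸ x

lastValue<1+m : ∀ m x h → lastValue m x h < suc m
lastValue<1+m m x h with isWeakStep x h
... | true  = n<1+n m
... | false = s≤s (m∸n≤m m x)

lastValue-weak : ∀ m h → lastValue m (suc h) h ≡ m
lastValue-weak m h rewrite isWeakStep-weak h = refl

lastValue-deficient : ∀ m {x h} → x ≤ h → lastValue m x h ≡ m ∸ x
lastValue-deficient m x≤h rewrite isWeakStep-deficient x≤h = refl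

lastValue+x≡m : ∀ m {x h} → x ≤ h → h ≤ m → lastValue m x h + x ≡ m
lastValue+x≡m m {x} x≤h h≤m = trans (cong (_+ x) (lastValue-deficient m x≤h)) (m∸n+n≡m (≤-trans x≤h h≤m))

lastValue<m : ∀ m {x h} → 1 ≤ x → x ≤ h → h ≤ m → lastValue m x h < m
lastValue<m m {x} {h} 1≤x x≤h h≤m = subst (lastValue m x h <_) (lastValue+x≡m m x≤h h≤m) (m<m+n _ 1≤x)

lastValue-injective : ∀ {m x y h} → Step x h → Step y h → h ≤ m → lastValue m x h ≡ lastValue m y h → x ≡ y
lastValue-injective weak weak _ _ = refl
lastValue-injective {m} {h = h} weak (deficient 1≤y y≤h) h≤m eq =
  contradiction (trans (sym (lastValue-weak m h)) eq) (<⇒≢ (lastValue<m m 1≤y y≤h h≤m) ∘ sym)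
lastValue-injective {m} {h = h} (deficient 1≤x x≤h) weak h≤m eq =
  contradiction (trans eq (lastValue-weak m h)) (<⇒≢ (lastValue<m m 1≤x x≤h h≤m))
lastValue-injective {m} {x} {y} (deficient _ x≤h) (deficient _ y≤h) h≤m eq =
  +-cancelˡ-≡ (lastValue m x _) x y
    (trans (lastValue+x≡m m x≤h h≤m) (sym (trans (cong (_+ y) eq) (lastValue+x≡m m y≤h h≤m))))

lastValue-surjective : ∀ m h v → v ≤ m → (v < m → m ∸ v ≤ h) →
                       ∃ λ x → 1 ≤ x × x ≤ suc h × lastValue m x h ≡ v
lastValue-surjective m h v v≤m bound with v ≟ m
... | yes refl = suc h , s≤s z≤n , ≤-refl , lastValue-weak m h
... | no  v≢m  = m ∸ v , m<n⇒0<n∸m v<m , m≤n⇒m≤1+n (bound v<m) ,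
                 trans (lastValue-deficient m (bound v<m)) (m∸[m∸n]≡n v≤m)
  where v<m = ≤∧≢⇒< v≤m v≢m

codeToPerm : (n : ℕ) → List ℕ → Perm n
codeToPerm zero    _        = id
codeToPerm (suc m) []       = id
codeToPerm (suc m) (x ∷ xs) = insert (fromℕ m) (fromℕ< (lastValue<1+m m x (head₀ xs))) (codeToPerm m xs)

entry : (n : ℕ) → List ℕ → Fin n → ℕ
entry n xs k = toℕ (codeToPerm n xs ⟨$⟩ʳ k)

entry≤ : ∀ m xs (k : Fin (suc m)) → entry (suc m) xs k ≤ m
entry≤ m xs k = s≤s⁻¹ (toℕ<n (codeToPerm (suc m) xs ⟨$⟩ʳ k))

module _ (m x : ℕ) (xs : List ℕ) where

  private
    v<1+m = lastValue<1+m m x (head₀ xs)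

  entry-last : entry (suc m) (x ∷ xs) (fromℕ m) ≡ lastValue m x (head₀ xs)
  entry-last = trans (cong toℕ (insert-last-last (fromℕ< v<1+m) (codeToPerm m xs))) (toℕ-fromℕ< v<1+m)

  entry-inject₁ : ∀ k → entry (suc m) (x ∷ xs) (inject₁ k) ≡ punchInℕ (lastValue m x (head₀ xs)) (entry m xs k)
  entry-inject₁ k = trans (toℕ-insert-last-inject₁ (fromℕ< v<1+m) (codeToPerm m xs) k)
                          (cong (λ i → punchInℕ i (entry m xs k)) (toℕ-fromℕ< v<1+m))

-- A value a with a + head₀ xs < n lies below every value appended later,
-- so later steps never shift it.
Frozen : ℕ → List ℕ → ℕ → Set
Frozen n xs a = a + head₀ xs < n

module _ {m x : ℕ} {xs : List ℕ} (1≤x : 1 ≤ x) (x≤1+h : x ≤ suc (head₀ xs)) (c : Code m xs) where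

  private
    h = head₀ xs

  frozen<lastValue : ∀ {a} → Frozen m xs a → a < lastValue m x h
  frozen<lastValue {a} a+h<m with step 1≤x x≤1+h
  ... | weak            = subst (a <_) (sym (lastValue-weak m h)) (≤-<-trans (m≤m+n a h) a+h<m)
  ... | deficient _ x≤h = +-cancelʳ-< x a _
          (subst (a + x <_) (sym (lastValue+x≡m m x≤h (head₀≤ c))) (≤-<-trans (+-monoʳ-≤ a x≤h) a+h<m))

  frozen-cons : ∀ {a} → Frozen m xs a → Frozen (suc m) (x ∷ xs) a
  frozen-cons {a} a+h<m = s≤s (≤-trans (+-monoʳ-≤ a x≤1+h) (subst (_≤ m) (sym (+-suc a h)) a+h<m))

  entry-inject₁-frozen : ∀ k → Frozen m xs (entry m xs k) → entry (suc m) (x ∷ xs) (inject₁ k) ≡ entry m xs k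
  entry-inject₁-frozen k frozen = trans (entry-inject₁ m x xs k) (punchInℕ-< (frozen<lastValue frozen))

  frozen-inject₁ : ∀ k → Frozen m xs (entry m xs k) → Frozen (suc m) (x ∷ xs) (entry (suc m) (x ∷ xs) (inject₁ k))
  frozen-inject₁ k frozen =
    subst (Frozen (suc m) (x ∷ xs)) (sym (entry-inject₁-frozen k frozen)) (frozen-cons frozen)

  frozen-last : x ≤ h → Frozen (suc m) (x ∷ xs) (entry (suc m) (x ∷ xs) (fromℕ m))
  frozen-last x≤h =
    subst (_< suc m) (sym (trans (cong (_+ x) (entry-last m x xs)) (lastValue+x≡m m x≤h (head₀≤ c)))) (n<1+n m)

inversion-frozen : ∀ {n xs} → Code n xs → (a b : Fin n) → Inversion (codeToPerm n xs) a b →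
                   Frozen n xs (entry n xs b)
inversion-frozen {suc m} {x ∷ xs} (cons 1≤x x≤1+h c) a b (a<b , ba) with lastView b
... | last with step 1≤x x≤1+h
...   | weak = contradiction (≤-trans ba (entry≤ m (x ∷ xs) a))
                             (<-irrefl (trans (entry-last m x xs) (lastValue-weak m (head₀ xs))))
...   | deficient _ x≤h = frozen-last 1≤x x≤1+h c x≤h
inversion-frozen {suc m} {x ∷ xs} (cons 1≤x x≤1+h c) a _ (a<b , ba) | inject b′ with lastView a
... | last      = contradiction a<b (fromℕ≮inject₁ b′)
... | inject a′ = frozen-inject₁ 1≤x x≤1+h c b′ (inversion-frozen c a′ b′
                    (inject₁-cancel-< a<b , insert-last-inject₁-cancel-< _ (codeToPerm m xs) ba))

deficiency-frozen : ∀ {n xs} → Code n xs → (k : Fin n) → entry n xs k < toℕ k → Frozen n xs (entry n xs k)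
deficiency-frozen {suc m} {x ∷ xs} (cons 1≤x x≤1+h c) k deficient-k with lastView k
... | last with step 1≤x x≤1+h
...   | weak = contradiction deficient-k
                 (<-irrefl (trans (trans (entry-last m x xs) (lastValue-weak m (head₀ xs))) (sym (toℕ-fromℕ m))))
...   | deficient _ x≤h = frozen-last 1≤x x≤1+h c x≤h
deficiency-frozen {suc m} {x ∷ xs} (cons 1≤x x≤1+h c) _ deficient-k | inject k′ =
  frozen-inject₁ 1≤x x≤1+h c k′ (deficiency-frozen c k′
    (≤-<-trans (j≤punchInℕ _ _) (subst₂ _<_ (entry-inject₁ m x xs k′) (toℕ-inject₁ k′) deficient-k)))

inversion-above : ∀ {n xs} → Code n xs → ∀ {w} → Frozen n xs w →
                  ∃ λ a → ∃ λ b → Inversion (codeToPerm n xs) a b × w ≤ entry n xs b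
inversion-above {suc m} {x ∷ xs} (cons 1≤x x≤1+h c) {w} frozen with step 1≤x x≤1+h
... | weak with inversion-above c (s≤s⁻¹ (subst (_< suc m) (+-suc w (head₀ xs)) frozen))
...   | a , b , (a<b , ba) , w≤b =
  inject₁ a , inject₁ b , (inject₁-mono-< a<b , insert-last-inject₁-mono-< _ (codeToPerm m xs) ba) ,
  subst (w ≤_) (sym (entry-inject₁ m x xs b)) (≤-trans w≤b (j≤punchInℕ _ _))
-- The largest value m sits before the new, smaller last entry.
inversion-above {suc m} {x ∷ xs} (cons 1≤x x≤1+h c) {w} frozen | deficient _ x≤h =
  top , fromℕ m , (top<last , subst (_< entry (suc m) (x ∷ xs) top) (sym (entry-last m x xs)) v<top) ,
  subst (w ≤_) (sym (entry-last m x xs))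
    (+-cancelʳ-≤ x w v (subst (w + x ≤_) (sym (lastValue+x≡m m x≤h (head₀≤ c))) (s≤s⁻¹ frozen)))
  where
  π = codeToPerm (suc m) (x ∷ xs)
  v = lastValue m x (head₀ xs)
  top = π ⟨$⟩ˡ fromℕ m
  v<top : v < entry (suc m) (x ∷ xs) top
  v<top = subst (v <_) (sym (trans (cong toℕ (inverseʳ π)) (toℕ-fromℕ m))) (lastValue<m m 1≤x x≤h (head₀≤ c))
  top≢last : toℕ top ≢ m
  top≢last top≡m = <⇒≢ v<top (trans (sym (entry-last m x xs))
    (cong (entry (suc m) (x ∷ xs)) (toℕ-injective (trans (toℕ-fromℕ m) (sym top≡m)))))
  top<last : toℕ top < toℕ (fromℕ m)
  top<last = subst (toℕ top <_) (sym (toℕ-fromℕ m)) (≤∧≢⇒< (s≤s⁻¹ (toℕ<n top)) top≢last)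

codeToPerm-avoids321 : ∀ {n xs} → Code n xs → Avoids321 (codeToPerm n xs)
codeToPerm-avoids321 nil ()
codeToPerm-avoids321 {suc m} {x ∷ xs} (cons 1≤x x≤1+h c) =
  avoids321-insert-last _ (codeToPerm m xs) (codeToPerm-avoids321 c) λ a b inv →
    subst (_ <_) (sym (toℕ-fromℕ< _)) (frozen<lastValue 1≤x x≤1+h c (inversion-frozen c a b inv))

codeToPerm-injective : ∀ {n xs ys} → Code n xs → Code n ys → codeToPerm n xs ≈ₚ codeToPerm n ys → xs ≡ ys
codeToPerm-injective nil nil _ = refl
codeToPerm-injective {suc m} {x ∷ xs} (cons 1≤x x≤1+h c) (cons 1≤y y≤1+h d) eq
  with insert-last-injective eq
... | last≡ , init≈ with codeToPerm-injective c d init≈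
...   | refl = cong (_∷ xs) (lastValue-injective (step 1≤x x≤1+h) (step 1≤y y≤1+h) (head₀≤ c)
                 (trans (sym (toℕ-fromℕ< _)) (trans (cong toℕ last≡) (toℕ-fromℕ< _))))

-- Were the appended value s a deficiency below m − head₀ xs, it would be frozen, and an
-- inversion lying above it would complete a 321 with it.
avoider-lastValue-bound : ∀ {m xs} → Code m xs → (s : Fin (suc m)) →
                          Avoids321 (insert (fromℕ m) s (codeToPerm m xs)) → toℕ s < m → m ∸ toℕ s ≤ head₀ xs
avoider-lastValue-bound {m} {xs} c s σ-avoids s<m with m ∸ toℕ s ≤? head₀ xs
... | yes bound = bound
... | no  ¬bound with inversion-above c frozen
  where
  frozen : Frozen m xs (toℕ s)
  frozen = subst (toℕ s + head₀ xs <_) (m+[n∸m]≡n (<⇒≤ s<m)) (+-monoʳ-< (toℕ s) (≰⇒> ¬bound))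
...   | a , b , (a<b , ba) , s≤b =
  contradiction
    (insert-last-inject₁-mono-< s π ba ,
     subst₂ _<_ (sym (cong toℕ (insert-last-last s π))) (sym (toℕ-insert-last-inject₁ s π b))
       (subst (toℕ s <_) (sym (punchInℕ-≥ s≤b)) (s≤s s≤b)))
    (σ-avoids (inject₁ a) (inject₁ b) (fromℕ m) (inject₁-mono-< a<b) (inject₁<fromℕ b))
  where π = codeToPerm m xs

extend-code : ∀ {m xs} → Code m xs → (s : Fin (suc m)) → Avoids321 (insert (fromℕ m) s (codeToPerm m xs)) →
              ∃ λ x → Code (suc m) (x ∷ xs) × codeToPerm (suc m) (x ∷ xs) ≈ₚ insert (fromℕ m) s (codeToPerm m xs)
extend-code {m} {xs} c s σ-avoids
  with lastValue-surjective m (head₀ xs) (toℕ s) (s≤s⁻¹ (toℕ<n s)) (avoider-lastValue-bound c s σ-avoids)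
... | x , 1≤x , x≤1+h , lastValue≡s =
  x , cons 1≤x x≤1+h c , insert-last-cong (toℕ-injective (trans (toℕ-fromℕ< _) lastValue≡s)) (λ _ → refl)

codeToPerm-surjective : ∀ n (σ : Perm n) → Avoids321 σ → ∃ λ xs → Code n xs × codeToPerm n xs ≈ₚ σ
codeToPerm-surjective zero    σ _        = [] , nil , λ ()
codeToPerm-surjective (suc m) σ σ-avoids
  with codeToPerm-surjective m (remove (fromℕ m) σ)
         (avoids321-insert-last⁻¹ (σ ⟨$⟩ʳ fromℕ m) (remove (fromℕ m) σ)
           (avoids321-insert-last-remove σ (λ _ → refl) σ-avoids))
... | xs , c , π≈τ with extend-code c (σ ⟨$⟩ʳ fromℕ m) (avoids321-insert-last-remove σ π≈τ σ-avoids)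
...   | x , c′ , π′≈ = x ∷ xs , c′ , λ k → trans (π′≈ k) (insert-last-remove σ π≈τ k)

stepWord : List ℕ → List Bool
stepWord []       = []
stepWord (x ∷ xs) = stepWord xs ∷ʳ not (isWeakStep x (head₀ xs))

stepWord-weak : ∀ xs → stepWord (suc (head₀ xs) ∷ xs) ≡ stepWord xs ∷ʳ false
stepWord-weak xs = cong (λ b → stepWord xs ∷ʳ not b) (isWeakStep-weak (head₀ xs))

stepWord-deficient : ∀ {x} xs → x ≤ head₀ xs → stepWord (x ∷ xs) ≡ stepWord xs ∷ʳ true
stepWord-deficient xs x≤h = cong (λ b → stepWord xs ∷ʳ not b) (isWeakStep-deficient x≤h)

tabulate-∷ʳ : ∀ {A : Set} n (f : Fin (suc n) → A) → tabulate f ≡ tabulate (f ∘ inject₁) ∷ʳ f (fromℕ n)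
tabulate-∷ʳ zero    f = refl
tabulate-∷ʳ (suc n) f = cong (f fzero ∷_) (tabulate-∷ʳ n (f ∘ fsuc))

seq-∷ʳ : ∀ {n} (f : Fin (suc n) → Bool) → seq f ≡ seq (f ∘ inject₁) ∷ʳ f (fromℕ n)
seq-∷ʳ {n} f = begin
  map f (allFin (suc n))                         ≡⟨ map-tabulate (λ i → i) f ⟩
  tabulate f                                     ≡⟨ tabulate-∷ʳ n f ⟩
  tabulate (f ∘ inject₁) ∷ʳ f (fromℕ n)          ≡⟨ cong (_∷ʳ f (fromℕ n)) (map-tabulate (λ i → i) (f ∘ inject₁)) ⟨
  map (f ∘ inject₁) (allFin n) ∷ʳ f (fromℕ n)    ∎
  where open ≡-Reasoning

module _ {m x : ℕ} {xs : List ℕ} (1≤x : 1 ≤ x) (x≤1+h : x ≤ suc (head₀ xs)) (c : Code m xs) where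

  private
    π = codeToPerm (suc m) (x ∷ xs)

  isDeficiency-inject₁ : ∀ k → isDeficiency π (inject₁ k) ≡ isDeficiency (codeToPerm m xs) k
  isDeficiency-inject₁ k with toℕ k ≤? entry m xs k
  ... | yes k≤e = trans (<ᵇ-false k′≤e′) (sym (<ᵇ-false k≤e))
    where
    k′≤e′ : toℕ (inject₁ k) ≤ entry (suc m) (x ∷ xs) (inject₁ k)
    k′≤e′ = subst₂ _≤_ (sym (toℕ-inject₁ k)) (sym (entry-inject₁ m x xs k)) (≤-trans k≤e (j≤punchInℕ _ _))
  ... | no  k≰e =
    cong₂ _<ᵇ_ (entry-inject₁-frozen 1≤x x≤1+h c k (deficiency-frozen c k (≰⇒> k≰e))) (toℕ-inject₁ k)

  isDeficiency-last : isDeficiency π (fromℕ m) ≡ not (isWeakStep x (head₀ xs))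
  isDeficiency-last with step 1≤x x≤1+h
  ... | weak = begin
    entry (suc m) (x ∷ xs) (fromℕ m) <ᵇ toℕ (fromℕ m)
      ≡⟨ cong₂ _<ᵇ_ (trans (entry-last m x xs) (lastValue-weak m _)) (toℕ-fromℕ m) ⟩
    m <ᵇ m
      ≡⟨ <ᵇ-false {m} ≤-refl ⟩
    false
      ≡⟨ cong not (isWeakStep-weak (head₀ xs)) ⟨
    not (isWeakStep x (head₀ xs))
      ∎
    where open ≡-Reasoning
  ... | deficient _ x≤h = begin
    entry (suc m) (x ∷ xs) (fromℕ m) <ᵇ toℕ (fromℕ m)
      ≡⟨ cong₂ _<ᵇ_ (entry-last m x xs) (toℕ-fromℕ m) ⟩
    lastValue m x (head₀ xs) <ᵇ m
      ≡⟨ <ᵇ-true (lastValue<m m 1≤x x≤h (head₀≤ c)) ⟩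
    true
      ≡⟨ cong not (isWeakStep-deficient x≤h) ⟨
    not (isWeakStep x (head₀ xs))
      ∎
    where open ≡-Reasoning

deficiencies-codeToPerm : ∀ {n xs} → Code n xs → seq (isDeficiency (codeToPerm n xs)) ≡ stepWord xs
deficiencies-codeToPerm nil = refl
deficiencies-codeToPerm {suc m} {x ∷ xs} (cons 1≤x x≤1+h c) = begin
  seq (isDeficiency π)
    ≡⟨ seq-∷ʳ (isDeficiency π) ⟩
  seq (isDeficiency π ∘ inject₁) ∷ʳ isDeficiency π (fromℕ m)
    ≡⟨ cong₂ _∷ʳ_ (map-cong (isDeficiency-inject₁ 1≤x x≤1+h c) (allFin m)) (isDeficiency-last 1≤x x≤1+h c) ⟩
  seq (isDeficiency (codeToPerm m xs)) ∷ʳ not (isWeakStep x (head₀ xs))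
    ≡⟨ cong (_∷ʳ _) (deficiencies-codeToPerm c) ⟩
  stepWord (x ∷ xs)
    ∎
  where
  open ≡-Reasoning
  π = codeToPerm (suc m) (x ∷ xs)

-- Plane trees grown along the rightmost path

leaf : PTree
leaf = node []

children : PTree → List PTree
children (node cs) = cs

-- graft t k hangs a new last child below the vertex at depth k of the rightmost path.
mutual
  graft : PTree → ℕ → PTree
  graft (node [])       _ = node (leaf ∷ [])
  graft (node (c ∷ cs)) k = node (toList (graftLast c cs k))

  graftLast : PTree → List PTree → ℕ → List⁺ PTree
  graftLast c []       zero    = c ∷⁺ [ leaf ]
  graftLast c []       (suc k) = [ graft c k ]
  graftLast c (d ∷ ds) k       = c ∷⁺ graftLast d ds k

mutual
  rightmostDepth : PTree → ℕ
  rightmostDepth (node [])       = 0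
  rightmostDepth (node (c ∷ cs)) = suc (lastChildDepth c cs)

  lastChildDepth : PTree → List PTree → ℕ
  lastChildDepth c []       = rightmostDepth c
  lastChildDepth c (d ∷ ds) = lastChildDepth d ds

mutual
  rightmostDepth-graft : ∀ t k → k ≤ rightmostDepth t → rightmostDepth (graft t k) ≡ suc k
  rightmostDepth-graft (node [])       zero _   = refl
  rightmostDepth-graft (node (c ∷ cs)) k    k≤d = cong suc (lastChildDepth-graftLast c cs k k≤d)

  lastChildDepth-graftLast : ∀ c cs k → k ≤ suc (lastChildDepth c cs) →
    let g = graftLast c cs k in lastChildDepth (head⁺ g) (tail⁺ g) ≡ k
  lastChildDepth-graftLast c []       zero    _   = refl
  lastChildDepth-graftLast c []       (suc k) k≤d = rightmostDepth-graft c k (s≤s⁻¹ k≤d)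
  lastChildDepth-graftLast c (d ∷ ds) k       k≤d = lastChildDepth-graftLast d ds k k≤d

edges-node-∷ : ∀ c cs → edges (node (c ∷ cs)) ≡ suc (edges c) + edges (node cs)
edges-node-∷ c cs = cong suc (x∙yz≈y∙xz (length cs) (edges c) (edgesL cs))

mutual
  edges-graft : ∀ t k → edges (graft t k) ≡ suc (edges t)
  edges-graft (node [])       _ = refl
  edges-graft (node (c ∷ cs)) k = edges-graftLast c cs k

  edges-graftLast : ∀ c cs k → edges (node (toList (graftLast c cs k))) ≡ suc (edges (node (c ∷ cs)))
  edges-graftLast c []       zero    = refl
  edges-graftLast c []       (suc k) = cong (λ e → suc (e + 0)) (edges-graft c k)
  edges-graftLast c (d ∷ ds) k       = begin
    edges (node (c ∷ toList g))            ≡⟨ edges-node-∷ c (toList g) ⟩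
    suc (edges c) + edges (node (toList g)) ≡⟨ cong (suc (edges c) +_) (edges-graftLast d ds k) ⟩
    suc (edges c) + suc (edges (node (d ∷ ds))) ≡⟨ +-suc (suc (edges c)) _ ⟩
    suc (suc (edges c) + edges (node (d ∷ ds))) ≡⟨ cong suc (edges-node-∷ c (d ∷ ds)) ⟨
    suc (edges (node (c ∷ d ∷ ds)))        ∎
    where
    open ≡-Reasoning
    g = graftLast d ds k

mutual
  ungraft : PTree → Maybe (PTree × ℕ)
  ungraft (node [])       = nothing
  ungraft (node (c ∷ cs)) = mapMaybe (map₁ node) (ungraftLast c cs)

  ungraftLast : PTree → List PTree → Maybe (List PTree × ℕ)
  ungraftLast c               (d ∷ ds) = mapMaybe (map₁ (c ∷_)) (ungraftLast d ds)
  ungraftLast (node [])       []       = just ([] , 0)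
  ungraftLast (node (e ∷ es)) []       = mapMaybe (map× (λ es′ → node es′ ∷ []) suc) (ungraftLast e es)

mutual
  ungraft-graft : ∀ t k → k ≤ rightmostDepth t → ungraft (graft t k) ≡ just (t , k)
  ungraft-graft (node [])       zero _   = refl
  ungraft-graft (node (c ∷ cs)) k    k≤d rewrite ungraftLast-graftLast c cs k k≤d = refl

  ungraftLast-graftLast : ∀ c cs k → k ≤ suc (lastChildDepth c cs) →
    let g = graftLast c cs k in ungraftLast (head⁺ g) (tail⁺ g) ≡ just (c ∷ cs , k)
  ungraftLast-graftLast c               []       zero          _   = refl
  ungraftLast-graftLast (node [])       []       (suc zero)    _   = refl
  ungraftLast-graftLast (node [])       []       (suc (suc k)) (s≤s ())
  ungraftLast-graftLast (node (e ∷ es)) []       (suc k)       k≤d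
    rewrite ungraftLast-graftLast e es k (s≤s⁻¹ k≤d) = refl
  ungraftLast-graftLast c               (d ∷ ds) k             k≤d
    rewrite ungraftLast-graftLast d ds k k≤d = refl

graft-injective : ∀ {t u k l} → k ≤ rightmostDepth t → l ≤ rightmostDepth u → graft t k ≡ graft u l →
                  t ≡ u × k ≡ l
graft-injective {t} {u} {k} {l} k≤d l≤d eq = ,-injective (just-injective
  (trans (sym (ungraft-graft t k k≤d)) (trans (cong ungraft eq) (ungraft-graft u l l≤d))))

graft-surjective : ∀ c cs → ∃ λ t → ∃ λ k → k ≤ rightmostDepth t × graft t k ≡ node (c ∷ cs)
graft-surjective (node [])       [] = leaf , 0 , z≤n , refl
graft-surjective (node (e ∷ es)) [] with graft-surjective e es
... | t , k , k≤d , eq = node (t ∷ []) , suc k , s≤s k≤d , cong (λ u → node (u ∷ [])) eq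
graft-surjective c (d ∷ ds) with graft-surjective d ds
... | node []       , k , k≤d , eq = node (c ∷ [])     , 0 , z≤n , cong (λ u → node (c ∷ children u)) eq
... | node (y ∷ ys) , k , k≤d , eq = node (c ∷ y ∷ ys) , k , k≤d , cong (λ u → node (c ∷ children u)) eq

-- Leaf statistics

data Position : Set where
  root leftmost notLeftmost : Position

mutual
  leafWeight : (Position → ℕ) → Position → PTree → ℕ
  leafWeight w p (node [])       = w p
  leafWeight w _ (node (c ∷ cs)) = leafWeight w leftmost c + forestWeight w cs

  forestWeight : (Position → ℕ) → List PTree → ℕ
  forestWeight w []       = 0
  forestWeight w (t ∷ ts) = leafWeight w notLeftmost t + forestWeight w ts

weight⁺ : (Position → ℕ) → Position → List⁺ PTree → ℕ
weight⁺ w p ts = leafWeight w p (head⁺ ts) + forestWeight w (tail⁺ ts)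

leafWeight-cong : ∀ w {p q} t → w p ≡ w q → leafWeight w p t ≡ leafWeight w q t
leafWeight-cong w (node [])      wp≡wq = wp≡wq
leafWeight-cong w (node (_ ∷ _)) _     = refl

mutual
  rightmostPosition : Position → PTree → Position
  rightmostPosition p (node [])       = p
  rightmostPosition _ (node (c ∷ cs)) = lastChildPosition leftmost c cs

  lastChildPosition : Position → PTree → List PTree → Position
  lastChildPosition p c []       = rightmostPosition p c
  lastChildPosition _ c (d ∷ ds) = lastChildPosition notLeftmost d ds

mutual
  rightmostPosition-graft-inner : ∀ p t k → k < rightmostDepth t → rightmostPosition p (graft t k) ≡ notLeftmost
  rightmostPosition-graft-inner p (node (c ∷ cs)) k (s≤s k≤d) = lastChildPosition-graftLast-inner leftmost c cs k k≤d

  lastChildPosition-graftLast-inner : ∀ p c cs k → k ≤ lastChildDepth c cs →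
    let g = graftLast c cs k in lastChildPosition p (head⁺ g) (tail⁺ g) ≡ notLeftmost
  lastChildPosition-graftLast-inner p c []       zero    _   = refl
  lastChildPosition-graftLast-inner p c []       (suc k) k<d = rightmostPosition-graft-inner p c k k<d
  lastChildPosition-graftLast-inner p c (d ∷ ds) k       k≤d =
    lastChildPosition-graftLast-inner notLeftmost d ds k k≤d

mutual
  rightmostPosition-graft-rightmostLeaf : ∀ p t → rightmostPosition p (graft t (rightmostDepth t)) ≡ leftmost
  rightmostPosition-graft-rightmostLeaf p (node [])       = refl
  rightmostPosition-graft-rightmostLeaf p (node (c ∷ cs)) = lastChildPosition-graftLast-rightmostLeaf leftmost c cs

  lastChildPosition-graftLast-rightmostLeaf : ∀ p c cs →
    let g = graftLast c cs (suc (lastChildDepth c cs)) in lastChildPosition p (head⁺ g) (tail⁺ g) ≡ leftmost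
  lastChildPosition-graftLast-rightmostLeaf p c []       = rightmostPosition-graft-rightmostLeaf p c
  lastChildPosition-graftLast-rightmostLeaf p c (d ∷ ds) = lastChildPosition-graftLast-rightmostLeaf notLeftmost d ds

module _ (w : Position → ℕ) where

  mutual
    leafWeight-graft-inner : ∀ p t k → k < rightmostDepth t →
                             leafWeight w p (graft t k) ≡ w notLeftmost + leafWeight w p t
    leafWeight-graft-inner p (node (c ∷ cs)) k (s≤s k≤d) = weight⁺-graftLast-inner leftmost c cs k k≤d

    weight⁺-graftLast-inner : ∀ p c cs k → k ≤ lastChildDepth c cs →
      weight⁺ w p (graftLast c cs k) ≡ w notLeftmost + (leafWeight w p c + forestWeight w cs)
    weight⁺-graftLast-inner p c []       zero    _   = x∙yz≈y∙xz (leafWeight w p c) (w notLeftmost) 0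
    weight⁺-graftLast-inner p c []       (suc k) k<d =
      trans (cong (_+ 0) (leafWeight-graft-inner p c k k<d)) (+-assoc (w notLeftmost) _ 0)
    weight⁺-graftLast-inner p c (d ∷ ds) k       k≤d =
      trans (cong (leafWeight w p c +_) (weight⁺-graftLast-inner notLeftmost d ds k k≤d))
            (x∙yz≈y∙xz (leafWeight w p c) (w notLeftmost) _)

  mutual
    leafWeight-graft-rightmostLeaf : ∀ p t →
      leafWeight w p (graft t (rightmostDepth t)) + w (rightmostPosition p t) ≡ w leftmost + leafWeight w p t
    leafWeight-graft-rightmostLeaf p (node [])       = cong (_+ w p) (+-identityʳ (w leftmost))
    leafWeight-graft-rightmostLeaf p (node (c ∷ cs)) = weight⁺-graftLast-rightmostLeaf leftmost c cs

    weight⁺-graftLast-rightmostLeaf : ∀ p c cs →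
      weight⁺ w p (graftLast c cs (suc (lastChildDepth c cs))) + w (lastChildPosition p c cs)
        ≡ w leftmost + (leafWeight w p c + forestWeight w cs)
    weight⁺-graftLast-rightmostLeaf p c [] = begin
      leafWeight w p (graft c (rightmostDepth c)) + 0 + w (rightmostPosition p c)
        ≡⟨ cong (_+ w (rightmostPosition p c)) (+-identityʳ _) ⟩
      leafWeight w p (graft c (rightmostDepth c)) + w (rightmostPosition p c)
        ≡⟨ leafWeight-graft-rightmostLeaf p c ⟩
      w leftmost + leafWeight w p c
        ≡⟨ cong (w leftmost +_) (+-identityʳ _) ⟨
      w leftmost + (leafWeight w p c + 0)
        ∎
      where open ≡-Reasoning
    weight⁺-graftLast-rightmostLeaf p c (d ∷ ds) = begin
      leafWeight w p c + weight⁺ w notLeftmost g + w (lastChildPosition notLeftmost d ds)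
        ≡⟨ +-assoc (leafWeight w p c) _ _ ⟩
      leafWeight w p c + (weight⁺ w notLeftmost g + w (lastChildPosition notLeftmost d ds))
        ≡⟨ cong (leafWeight w p c +_) (weight⁺-graftLast-rightmostLeaf notLeftmost d ds) ⟩
      leafWeight w p c + (w leftmost + (leafWeight w notLeftmost d + forestWeight w ds))
        ≡⟨ x∙yz≈y∙xz (leafWeight w p c) (w leftmost) _ ⟩
      w leftmost + (leafWeight w p c + (leafWeight w notLeftmost d + forestWeight w ds))
        ∎
      where
      open ≡-Reasoning
      g = graftLast d ds (suc (lastChildDepth d ds))

youngWeight : Position → ℕ
youngWeight notLeftmost = 1
youngWeight _           = 0

oldWeight : Position → ℕ
oldWeight leftmost = 1
oldWeight _        = 0

mutual
  youngLeaves-leafWeight : ∀ t → youngLeaves t ≡ leafWeight youngWeight leftmost t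
  youngLeaves-leafWeight (node [])       = refl
  youngLeaves-leafWeight (node (c ∷ cs)) =
    trans (x∙yz≈y∙xz (leafCount cs) (youngLeaves c) (youngLeavesL cs))
          (cong₂ _+_ (youngLeaves-leafWeight c) (youngLeavesL-forestWeight cs))

  youngLeavesL-forestWeight : ∀ ts → leafCount ts + youngLeavesL ts ≡ forestWeight youngWeight ts
  youngLeavesL-forestWeight []       = refl
  youngLeavesL-forestWeight (t ∷ ts) =
    trans (interchange (b2n (isLeaf t)) (leafCount ts) (youngLeaves t) (youngLeavesL ts))
          (cong₂ _+_ (youngLeaves-notLeftmost t) (youngLeavesL-forestWeight ts))

  youngLeaves-notLeftmost : ∀ t → b2n (isLeaf t) + youngLeaves t ≡ leafWeight youngWeight notLeftmost t
  youngLeaves-notLeftmost (node [])       = refl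
  youngLeaves-notLeftmost (node (c ∷ cs)) = youngLeaves-leafWeight (node (c ∷ cs))

mutual
  oldLeaves-leafWeight : ∀ t → oldLeaves t ≡ leafWeight oldWeight notLeftmost t
  oldLeaves-leafWeight (node [])       = refl
  oldLeaves-leafWeight (node (c ∷ cs)) =
    trans (sym (+-assoc (b2n (isLeaf c)) (oldLeaves c) (oldLeavesL cs)))
          (cong₂ _+_ (oldLeaves-leftmost c) (oldLeavesL-forestWeight cs))

  oldLeavesL-forestWeight : ∀ ts → oldLeavesL ts ≡ forestWeight oldWeight ts
  oldLeavesL-forestWeight []       = refl
  oldLeavesL-forestWeight (t ∷ ts) = cong₂ _+_ (oldLeaves-leafWeight t) (oldLeavesL-forestWeight ts)

  oldLeaves-leftmost : ∀ t → b2n (isLeaf t) + oldLeaves t ≡ leafWeight oldWeight leftmost t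
  oldLeaves-leftmost (node [])       = refl
  oldLeaves-leftmost (node (c ∷ cs)) = oldLeaves-leafWeight (node (c ∷ cs))

codeToTree : List ℕ → PTree
codeToTree []       = leaf
codeToTree (x ∷ xs) = graft (codeToTree xs) (pred x)

rightmostDepth-codeToTree : ∀ {n xs} → Code n xs → rightmostDepth (codeToTree xs) ≡ head₀ xs
rightmostDepth-codeToTree nil = refl
rightmostDepth-codeToTree (cons (s≤s z≤n) x≤1+h c) =
  rightmostDepth-graft _ _ (subst (_ ≤_) (sym (rightmostDepth-codeToTree c)) (s≤s⁻¹ x≤1+h))

pred≤rightmostDepth : ∀ {n x xs} → Code n xs → 1 ≤ x → x ≤ suc (head₀ xs) → pred x ≤ rightmostDepth (codeToTree xs)
pred≤rightmostDepth c (s≤s z≤n) x≤1+h = subst (_ ≤_) (sym (rightmostDepth-codeToTree c)) (s≤s⁻¹ x≤1+h)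

pred<rightmostDepth : ∀ {n x xs} → Code n xs → 1 ≤ x → x ≤ head₀ xs → pred x < rightmostDepth (codeToTree xs)
pred<rightmostDepth c (s≤s z≤n) x≤h = subst (_ <_) (sym (rightmostDepth-codeToTree c)) x≤h

codeToTree-weak : ∀ {n xs} → Code n xs →
                  codeToTree (suc (head₀ xs) ∷ xs) ≡ graft (codeToTree xs) (rightmostDepth (codeToTree xs))
codeToTree-weak {xs = xs} c = cong (graft (codeToTree xs)) (sym (rightmostDepth-codeToTree c))

edges-codeToTree : ∀ {n xs} → Code n xs → edges (codeToTree xs) ≡ n
edges-codeToTree nil                         = refl
edges-codeToTree {xs = x ∷ xs} (cons _ _ c) =
  trans (edges-graft (codeToTree xs) (pred x)) (cong suc (edges-codeToTree c))

codeToTree-injective : ∀ {n xs ys} → Code n xs → Code n ys → codeToTree xs ≡ codeToTree ys → xs ≡ ys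
codeToTree-injective nil nil _ = refl
codeToTree-injective (cons 1≤x@(s≤s z≤n) x≤1+h c) (cons 1≤y@(s≤s z≤n) y≤1+h d) eq
  with graft-injective (pred≤rightmostDepth c 1≤x x≤1+h) (pred≤rightmostDepth d 1≤y y≤1+h) eq
... | tree≡ , pred≡ = cong₂ _∷_ (cong suc pred≡) (codeToTree-injective c d tree≡)

treeToCode : ∀ n t → edges t ≡ n → ∃ λ xs → Code n xs × codeToTree xs ≡ t
treeToCode zero    (node [])       _ = [] , nil , refl
treeToCode (suc m) (node (c ∷ cs)) e with graft-surjective c cs
... | t , k , k≤d , graft≡
  with treeToCode m t (suc-injective (trans (sym (edges-graft t k)) (trans (cong edges graft≡) e)))
...   | xs , code , refl =
  suc k ∷ xs , cons (s≤s z≤n) (s≤s (subst (k ≤_) (rightmostDepth-codeToTree code) k≤d)) code , graft≡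

stepPosition : Bool → Position
stepPosition true  = notLeftmost
stepPosition false = leftmost

lastPosition : List Bool → Position
lastPosition []           = root
lastPosition (b ∷ [])     = stepPosition b
lastPosition (_ ∷ b ∷ bs) = lastPosition (b ∷ bs)

lastPosition-∷ʳ : ∀ bs b → lastPosition (bs ∷ʳ b) ≡ stepPosition b
lastPosition-∷ʳ []           b = refl
lastPosition-∷ʳ (_ ∷ [])     b = refl
lastPosition-∷ʳ (_ ∷ c ∷ bs) b = lastPosition-∷ʳ (c ∷ bs) b

rightmostPosition-codeToTree : ∀ {n xs} → Code n xs →
                               rightmostPosition root (codeToTree xs) ≡ lastPosition (stepWord xs)
rightmostPosition-codeToTree nil = refl
rightmostPosition-codeToTree {xs = x ∷ xs} (cons 1≤x x≤1+h c) with step 1≤x x≤1+h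
... | weak = begin
  rightmostPosition root (codeToTree (suc (head₀ xs) ∷ xs))
    ≡⟨ cong (rightmostPosition root) (codeToTree-weak c) ⟩
  rightmostPosition root (graft (codeToTree xs) (rightmostDepth (codeToTree xs)))
    ≡⟨ rightmostPosition-graft-rightmostLeaf root (codeToTree xs) ⟩
  leftmost
    ≡⟨ trans (cong lastPosition (stepWord-weak xs)) (lastPosition-∷ʳ (stepWord xs) false) ⟨
  lastPosition (stepWord (suc (head₀ xs) ∷ xs))
    ∎
  where open ≡-Reasoning
... | deficient 1≤x′ x≤h = begin
  rightmostPosition root (graft (codeToTree xs) (pred x))
    ≡⟨ rightmostPosition-graft-inner root _ _ (pred<rightmostDepth c 1≤x′ x≤h) ⟩
  notLeftmost
    ≡⟨ trans (cong lastPosition (stepWord-deficient xs x≤h)) (lastPosition-∷ʳ (stepWord xs) true) ⟨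
  lastPosition (stepWord (x ∷ xs))
    ∎
  where open ≡-Reasoning

module _ (w : Position → ℕ) (S : List Bool → ℕ) (S-[] : S [] ≡ w root)
         (S-deficient : ∀ bs → S (bs ∷ʳ true) ≡ w notLeftmost + S bs)
         (S-weak : ∀ bs → S (bs ∷ʳ false) + w (lastPosition bs) ≡ w leftmost + S bs) where

  leafWeight-codeToTree : ∀ {n xs} → Code n xs → leafWeight w root (codeToTree xs) ≡ S (stepWord xs)
  leafWeight-codeToTree nil = sym S-[]
  leafWeight-codeToTree {xs = x ∷ xs} (cons 1≤x x≤1+h c) with step 1≤x x≤1+h
  ... | weak = +-cancelʳ-≡ (w (lastPosition (stepWord xs))) _ _ (begin
    leafWeight w root (codeToTree (suc (head₀ xs) ∷ xs)) + w (lastPosition (stepWord xs))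
      ≡⟨ cong₂ (λ t p → leafWeight w root t + w p) (codeToTree-weak c) (sym (rightmostPosition-codeToTree c)) ⟩
    leafWeight w root (graft T (rightmostDepth T)) + w (rightmostPosition root T)
      ≡⟨ leafWeight-graft-rightmostLeaf w root T ⟩
    w leftmost + leafWeight w root T
      ≡⟨ cong (w leftmost +_) (leafWeight-codeToTree c) ⟩
    w leftmost + S (stepWord xs)
      ≡⟨ S-weak (stepWord xs) ⟨
    S (stepWord xs ∷ʳ false) + w (lastPosition (stepWord xs))
      ≡⟨ cong (λ bs → S bs + w (lastPosition (stepWord xs))) (stepWord-weak xs) ⟨
    S (stepWord (suc (head₀ xs) ∷ xs)) + w (lastPosition (stepWord xs))
      ∎)
    where
    open ≡-Reasoning
    T = codeToTree xs
  ... | deficient 1≤x′ x≤h = begin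
    leafWeight w root (graft (codeToTree xs) (pred x))
      ≡⟨ leafWeight-graft-inner w root _ _ (pred<rightmostDepth c 1≤x′ x≤h) ⟩
    w notLeftmost + leafWeight w root (codeToTree xs)
      ≡⟨ cong (w notLeftmost +_) (leafWeight-codeToTree c) ⟩
    w notLeftmost + S (stepWord xs)
      ≡⟨ S-deficient (stepWord xs) ⟨
    S (stepWord xs ∷ʳ true)
      ≡⟨ cong S (stepWord-deficient xs x≤h) ⟨
    S (stepWord (x ∷ xs))
      ∎
    where open ≡-Reasoning

adjTT-∷ʳ-true : ∀ bs → adjTT (bs ∷ʳ true) ≡ adjTT bs + lastTrue bs
adjTT-∷ʳ-true []                   = refl
adjTT-∷ʳ-true (true  ∷ [])         = refl
adjTT-∷ʳ-true (false ∷ [])         = refl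
adjTT-∷ʳ-true (true  ∷ true  ∷ bs) = cong suc (adjTT-∷ʳ-true (true ∷ bs))
adjTT-∷ʳ-true (true  ∷ false ∷ bs) = adjTT-∷ʳ-true (false ∷ bs)
adjTT-∷ʳ-true (false ∷ b     ∷ bs) = adjTT-∷ʳ-true (b ∷ bs)

adjTT-∷ʳ-false : ∀ bs → adjTT (bs ∷ʳ false) ≡ adjTT bs
adjTT-∷ʳ-false []                   = refl
adjTT-∷ʳ-false (true  ∷ [])         = refl
adjTT-∷ʳ-false (false ∷ [])         = refl
adjTT-∷ʳ-false (true  ∷ true  ∷ bs) = cong suc (adjTT-∷ʳ-false (true ∷ bs))
adjTT-∷ʳ-false (true  ∷ false ∷ bs) = adjTT-∷ʳ-false (false ∷ bs)
adjTT-∷ʳ-false (false ∷ b     ∷ bs) = adjTT-∷ʳ-false (b ∷ bs)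

lastTrue-∷ʳ : ∀ bs b → lastTrue (bs ∷ʳ b) ≡ b2n b
lastTrue-∷ʳ []           b = refl
lastTrue-∷ʳ (_ ∷ [])     b = refl
lastTrue-∷ʳ (_ ∷ c ∷ bs) b = lastTrue-∷ʳ (c ∷ bs) b

runEnds-∷ʳ-false : ∀ bs → runEnds (bs ∷ʳ false) ≡ runEnds bs
runEnds-∷ʳ-false []                   = refl
runEnds-∷ʳ-false (true  ∷ [])         = refl
runEnds-∷ʳ-false (false ∷ [])         = refl
runEnds-∷ʳ-false (true  ∷ true  ∷ bs) = runEnds-∷ʳ-false (true ∷ bs)
runEnds-∷ʳ-false (true  ∷ false ∷ bs) = cong suc (runEnds-∷ʳ-false (false ∷ bs))
runEnds-∷ʳ-false (false ∷ b     ∷ bs) = runEnds-∷ʳ-false (b ∷ bs)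

runEnds-∷ʳ-true : ∀ bs → runEnds (bs ∷ʳ true) + lastTrue bs ≡ suc (runEnds bs)
runEnds-∷ʳ-true []                   = refl
runEnds-∷ʳ-true (true  ∷ [])         = refl
runEnds-∷ʳ-true (false ∷ [])         = refl
runEnds-∷ʳ-true (true  ∷ true  ∷ bs) = runEnds-∷ʳ-true (true ∷ bs)
runEnds-∷ʳ-true (true  ∷ false ∷ bs) = cong suc (runEnds-∷ʳ-true (false ∷ bs))
runEnds-∷ʳ-true (false ∷ b     ∷ bs) = runEnds-∷ʳ-true (b ∷ bs)

youngWeight-lastPosition : ∀ bs → youngWeight (lastPosition bs) ≡ lastTrue bs
youngWeight-lastPosition []           = refl
youngWeight-lastPosition (true  ∷ []) = refl
youngWeight-lastPosition (false ∷ []) = refl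
youngWeight-lastPosition (_ ∷ b ∷ bs) = youngWeight-lastPosition (b ∷ bs)

oldWeight-lastPosition : ∀ bs → oldWeight (lastPosition bs) ≡ lastTrue (map not bs)
oldWeight-lastPosition []           = refl
oldWeight-lastPosition (true  ∷ []) = refl
oldWeight-lastPosition (false ∷ []) = refl
oldWeight-lastPosition (_ ∷ b ∷ bs) = oldWeight-lastPosition (b ∷ bs)

map-not-∷ʳ : ∀ bs b → map not (bs ∷ʳ b) ≡ map not bs ∷ʳ not b
map-not-∷ʳ bs b = map-++ not bs (b ∷ [])

youngLeaves-codeToTree : ∀ {n xs} → Code n xs → youngLeaves (codeToTree xs) ≡ stat1 (codeToPerm n xs)
youngLeaves-codeToTree {n} {xs} c = begin
  youngLeaves (codeToTree xs)                     ≡⟨ youngLeaves-leafWeight (codeToTree xs) ⟩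
  leafWeight youngWeight leftmost (codeToTree xs) ≡⟨ leafWeight-cong youngWeight (codeToTree xs) refl ⟩
  leafWeight youngWeight root (codeToTree xs)     ≡⟨ leafWeight-codeToTree youngWeight S refl S-deficient S-weak c ⟩
  S (stepWord xs)                                 ≡⟨ cong S (deficiencies-codeToPerm c) ⟨
  stat1 (codeToPerm n xs)                         ∎
  where
  open ≡-Reasoning
  S : List Bool → ℕ
  S bs = adjTT bs + lastTrue bs
  S-deficient : ∀ bs → S (bs ∷ʳ true) ≡ 1 + S bs
  S-deficient bs = trans (cong₂ _+_ (adjTT-∷ʳ-true bs) (lastTrue-∷ʳ bs true)) (+-comm (S bs) 1)
  S-weak : ∀ bs → S (bs ∷ʳ false) + youngWeight (lastPosition bs) ≡ 0 + S bs
  S-weak bs = cong₂ _+_ (trans (cong₂ _+_ (adjTT-∷ʳ-false bs) (lastTrue-∷ʳ bs false)) (+-identityʳ (adjTT bs)))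
                        (youngWeight-lastPosition bs)

oldLeaves-codeToTree : ∀ {n xs} → Code n xs → oldLeaves (codeToTree xs) ≡ stat2 (codeToPerm n xs)
oldLeaves-codeToTree {n} {xs} c = begin
  oldLeaves (codeToTree xs)                        ≡⟨ oldLeaves-leafWeight (codeToTree xs) ⟩
  leafWeight oldWeight notLeftmost (codeToTree xs) ≡⟨ leafWeight-cong oldWeight (codeToTree xs) refl ⟩
  leafWeight oldWeight root (codeToTree xs)        ≡⟨ leafWeight-codeToTree oldWeight S refl S-deficient S-weak c ⟩
  S (stepWord xs)                                  ≡⟨ cong S (deficiencies-codeToPerm c) ⟨
  S (seq (isDeficiency (codeToPerm n xs)))         ≡⟨ cong runEnds (map-∘ (allFin n)) ⟨
  stat2 (codeToPerm n xs)                          ∎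
  where
  open ≡-Reasoning
  S : List Bool → ℕ
  S bs = runEnds (map not bs)
  S-deficient : ∀ bs → S (bs ∷ʳ true) ≡ 0 + S bs
  S-deficient bs = trans (cong runEnds (map-not-∷ʳ bs true)) (runEnds-∷ʳ-false (map not bs))
  S-weak : ∀ bs → S (bs ∷ʳ false) + oldWeight (lastPosition bs) ≡ 1 + S bs
  S-weak bs = trans (cong₂ _+_ (cong runEnds (map-not-∷ʳ bs false)) (oldWeight-lastPosition bs))
                    (runEnds-∷ʳ-true (map not bs))

treeCode : ∀ {n} → Trees n → List ℕ
treeCode {n} (t , e) = proj₁ (treeToCode n t e)

treeCode-isCode : ∀ {n} (T : Trees n) → Code n (treeCode T)
treeCode-isCode {n} (t , e) = proj₁ (proj₂ (treeToCode n t e))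

codeToTree-treeCode : ∀ {n} (T : Trees n) → codeToTree (treeCode T) ≡ proj₁ T
codeToTree-treeCode {n} (t , e) = proj₂ (proj₂ (treeToCode n t e))

treeToPerm : ∀ {n} → Trees n → Perm n
treeToPerm {n} T = codeToPerm n (treeCode T)

treeToPerm-injective : ∀ {n} (T U : Trees n) → treeToPerm T ≈ₚ treeToPerm U → proj₁ T ≡ proj₁ U
treeToPerm-injective T U eq = begin
  proj₁ T                   ≡⟨ codeToTree-treeCode T ⟨
  codeToTree (treeCode T)   ≡⟨ cong codeToTree (codeToPerm-injective (treeCode-isCode T) (treeCode-isCode U) eq) ⟩
  codeToTree (treeCode U)   ≡⟨ codeToTree-treeCode U ⟩
  proj₁ U                   ∎
  where open ≡-Reasoning

treeToPerm-surjective : ∀ {n} (σ : Perm n) → Avoids321 σ → ∃ λ (T : Trees n) → treeToPerm T ≈ₚ σ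
treeToPerm-surjective {n} σ σ-avoids with codeToPerm-surjective n σ σ-avoids
... | xs , c , π≈σ = T , λ k → trans (cong (λ ys → codeToPerm n ys ⟨$⟩ʳ k) treeCode≡xs) (π≈σ k)
  where
  T = codeToTree xs , edges-codeToTree c
  treeCode≡xs = codeToTree-injective (treeCode-isCode T) c (codeToTree-treeCode T)

leaves-treeToPerm : ∀ {n} (T : Trees n) →
                    youngLeaves (proj₁ T) ≡ stat1 (treeToPerm T) × oldLeaves (proj₁ T) ≡ stat2 (treeToPerm T)
leaves-treeToPerm T = subst (λ t → youngLeaves t ≡ stat1 (treeToPerm T) × oldLeaves t ≡ stat2 (treeToPerm T))
  (codeToTree-treeCode T) (youngLeaves-codeToTree (treeCode-isCode T) , oldLeaves-codeToTree (treeCode-isCode T))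

mainTheorem7 : (n : ℕ) → 1 ≤ n →
    Σ (Trees n → Perm n) λ φ →
      ((T : Trees n) → Avoids321 (φ T))
      × ((T U : Trees n) → φ T ≈ₚ φ U → proj₁ T ≡ proj₁ U)
      × ((σ : Perm n) → Avoids321 σ → ∃ λ (T : Trees n) → φ T ≈ₚ σ)
      × ((T : Trees n) →
           (youngLeaves (proj₁ T) ≡ stat1 (φ T))
           × (oldLeaves (proj₁ T) ≡ stat2 (φ T)))
mainTheorem7 n _ =
  treeToPerm ,
  (λ T → codeToPerm-avoids321 (treeCode-isCode T)) ,
  treeToPerm-injective ,
  treeToPerm-surjective ,
  leaves-treeToPerm
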